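{- Let $k\ge1$ and $n\ge0$ be integers. (i) If $N=\binom{n+k}{k}-1$, then $C_{N,k}=\frac{kn}{k+1}(N+1)$. (ii) If $\binom{n+k-1}{k}\le N\le\binom{n+k}{k}-1$, then $C_{N,k}\ge\frac{k}{k+1}(n-1)N$, and thus $A_{N,k}\ge\frac{k}{k+1}(n-1)\ge\frac12(n-1)$.
   Context: The $(N,k)$-growth game: there are $k$ subarrays $A_1,\dots,A_k$, initially empty, with $a_i$ items in $A_i$; all nonempty subarrays are full and the empty ones form a prefix. $N$ items are inserted one at a time: if some subarray is empty, the last empty subarray $A_i$ (largest $i$ with $a_i=0$) becomes a subarray containing just the new item, cost $1$; otherwise the player chooses $i\in\{1,\dots,k\}$, and $A_1,\dots,A_i$ together with the new item are merged into a new $A_i$ with $a_i\leftarrow 1+\sum_{j=1}^i a_j$, while $A_1,\dots,A_{i-1}$ become empty; cost $1+\sum_{j=1}^i a_j$. $C_{N,k}$ is the minimum total cost of inserting $N$ items and $A_{N,k}=C_{N,k}/N$ (for $N\ge1$). Binomial coefficients satisfy $\binom{m}{j}=0$ for $0\le m<j$. -}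

module Defs where

open import Data.Nat using (ℕ; zero; suc; _+_; _*_; _≤_)
open import Data.Fin using (Fin; zero; suc)
open import Data.Vec using (Vec; []; _∷_; replicate)
open import Data.Product using (_×_; _,_; Σ)
open import Data.Bool using (Bool; true; false)
open import Relation.Binary.PropositionalEquality using (_≡_)

-- A configuration of the (N,k)-growth game: the sizes a₁,…,a_k.
State : ℕ → Set
State k = Vec ℕ k

initial : (k : ℕ) → State k
initial k = replicate k 0

-- Forced move: if some subarray is empty, fill the LAST empty one
-- (largest index i with aᵢ = 0) with the new item (cost 1).
-- Returns (didFill , newState).
fillLastEmpty : {k : ℕ} → State k → Bool × State k
fillLastEmpty [] = false , []
fillLastEmpty (a ∷ as) with fillLastEmpty as
... | true , as' = true , (a ∷ as')
... | false , as' with a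
...   | zero  = true , (1 ∷ as')
...   | suc m = false , (suc m ∷ as')

-- Merge move with choice i: A₁..Aᵢ plus the new item merged into Aᵢ,
-- A₁..A_{i-1} emptied.  Returns (cost , newState), cost = 1 + Σ_{j≤i} aⱼ.
-- Helper: carry s = number of items accumulated from earlier subarrays.
mergeAux : {k : ℕ} → ℕ → Fin k → State k → ℕ × State k
mergeAux s zero    (a ∷ as) = (s + a) , ((s + a) ∷ as)
mergeAux s (suc i) (a ∷ as) with mergeAux (s + a) i as
... | c , as' = c , (0 ∷ as')

merge : {k : ℕ} → Fin k → State k → ℕ × State k
merge i st = mergeAux 1 i st

step : {k : ℕ} → Fin k → State k → ℕ × State k
step i st with fillLastEmpty st
... | true , st' = 1 , st'
... | false  , _   = merge i st

-- Total cost of inserting N items from state st, following the choice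
-- sequence (the choice at a forced step is ignored).
runCost : {k N : ℕ} → Vec (Fin k) N → State k → ℕ
runCost [] st = 0
runCost (i ∷ is) st with step i st
... | c , st' = c + runCost is st'

strategyCost : (N k : ℕ) → Vec (Fin k) N → ℕ
strategyCost N k σ = runCost σ (initial k)

IsMinCost : (N k c : ℕ) → Set
IsMinCost N k c =
  Σ (Vec (Fin k) N) (λ σ → strategyCost N k σ ≡ c) ×
  ((σ : Vec (Fin k) N) → c ≤ strategyCost N k σ)

{-# OPTIONS --safe #-}
-- The lower bound is an amortised argument. Let θ⁰ = 0 and θʳ⁺¹ = cumulative 1 θʳ, so that θʳ sums
-- to C(r+k,k) − 1, and give a configuration a the potential Φ_R(a) = Σ_{r<R} Σ_i (a_i ∸ θʳ_i).
-- A forced fill raises Φ_R by at most 1, because θʳ is positive for r ≥ 1. A merge at i creates a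
-- subarray whose excess over θʳ⁺¹_i is at most the excess of A₁ … A_i over θʳ, so the merged items
-- move up one level and Φ_R grows by at most the cost of the move. After N insertions
-- Φ_R ≥ Σ_{r<R} (N ∸ (C(r+k,k) − 1)), and the hockey-stick and absorption identities for binomial
-- coefficients turn this into the stated bounds.
-- For the matching upper bound, the strategy for k subarrays and C(n+k,k) − 1 items plays the one
-- for C(n+k−1,k) − 1 items, merges everything into A_k, and then plays the one for k − 1 subarrays
-- and C(n+k−1,k−1) − 1 items on A₁ … A_{k−1}. It ends in θⁿ, which makes the lower bound tight.
module Submission where

open import Defs
open import Data.Nat using (ℕ; suc; _+_; _*_; _∸_; _≤_; _≥_; NonZero)
open import Data.Nat.Combinatorics using (_C_)
open import Data.Product using (_×_)
open import Relation.Binary.PropositionalEquality using (_≡_)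
open import Data.Integer using (+_)
open import Data.Rational using (ℚ; _/_) renaming (_≤_ to _≤ℚ_)

open import Data.Bool using (Bool; true; false)
open import Data.Fin using (Fin; zero; suc; fromℕ; inject₁)
open import Data.Integer.Properties using (pos-*)
open import Function using (_∘_)
import Data.Integer as ℤ
open import Data.Nat using (zero; z≤n; s≤s)
open import Data.Nat.Combinatorics using (nCn≡1; nCk+nC[k+1]≡[n+1]C[k+1])
open import Data.Nat.Properties
open import Algebra.Properties.CommutativeSemigroup +-commutativeSemigroup using (interchange)
open import Algebra.Properties.CommutativeSemigroup *-commutativeSemigroup
  using () renaming (x∙yz≈y∙xz to m*[n*o]≡n*[m*o])
open import Data.Nat.Tactic.RingSolver using (solve-∀)
open import Data.Product using (_,_; proj₁; proj₂)
open import Data.Rational.Properties using (toℚᵘ-cancel-≤; toℚᵘ-fromℚᵘ)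
import Data.Rational.Unnormalised as ℚᵘ
import Data.Rational.Unnormalised.Properties as ℚᵘ
open import Data.Vec using (Vec; []; _∷_; _++_; _∷ʳ_; map; sum)
open import Relation.Binary.PropositionalEquality
  using (refl; sym; trans; cong; cong₂; subst; subst₂; module ≡-Reasoning)

sumBelow : (ℕ → ℕ) → ℕ → ℕ
sumBelow f zero    = 0
sumBelow f (suc n) = f n + sumBelow f n

sumBelow-mono : ∀ {f g} → (∀ r → f r ≤ g r) → ∀ n → sumBelow f n ≤ sumBelow g n
sumBelow-mono f≤g zero    = z≤n
sumBelow-mono f≤g (suc n) = +-mono-≤ (f≤g n) (sumBelow-mono f≤g n)

*≤sumBelow+sumBelow : ∀ {x f g} → (∀ r → x ≤ f r + g r) →
                      ∀ n → n * x ≤ sumBelow f n + sumBelow g n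
*≤sumBelow+sumBelow         x≤f+g zero    = z≤n
*≤sumBelow+sumBelow {f = f} {g} x≤f+g (suc n) = begin
  _ + n * _                                      ≤⟨ +-mono-≤ (x≤f+g n) (*≤sumBelow+sumBelow x≤f+g n) ⟩
  (f n + g n) + (sumBelow f n + sumBelow g n)    ≡⟨ interchange (f n) (g n) _ _ ⟩
  sumBelow f (suc n) + sumBelow g (suc n)        ∎
  where open ≤-Reasoning

pascal : ℕ → ℕ → ℕ
pascal zero    n       = 1
pascal (suc k) zero    = 1
pascal (suc k) (suc n) = pascal k (suc n) + pascal (suc k) n

pascal≡C : ∀ k n → pascal k n ≡ (n + k) C k
pascal≡C zero    n       = refl
pascal≡C (suc k) zero    = sym (nCn≡1 (suc k))
pascal≡C (suc k) (suc n) = begin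
  pascal k (suc n) + pascal (suc k) n        ≡⟨ cong₂ _+_ (pascal≡C k (suc n)) (pascal≡C (suc k) n) ⟩
  (suc n + k) C k + (n + suc k) C suc k     ≡⟨ cong (λ m → m C k + (n + suc k) C suc k) (sym (+-suc n k)) ⟩
  (n + suc k) C k + (n + suc k) C suc k     ≡⟨ nCk+nC[k+1]≡[n+1]C[k+1] (n + suc k) k ⟩
  (suc n + suc k) C suc k                   ∎
  where open ≡-Reasoning

pascal[1,n]≡1+n : ∀ n → pascal 1 n ≡ suc n
pascal[1,n]≡1+n zero    = refl
pascal[1,n]≡1+n (suc n) = cong suc (pascal[1,n]≡1+n n)

pascal[k,1]≡1+k : ∀ k → pascal k 1 ≡ suc k
pascal[k,1]≡1+k zero    = refl
pascal[k,1]≡1+k (suc k) = trans (+-comm (pascal k 1) 1) (cong suc (pascal[k,1]≡1+k k))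

pascal-hockeyStick : ∀ k n → sumBelow (pascal k) (suc n) ≡ pascal (suc k) n
pascal-hockeyStick zero    zero    = refl
pascal-hockeyStick (suc k) zero    = refl
pascal-hockeyStick k       (suc n) = cong (_+_ (pascal k (suc n))) (pascal-hockeyStick k n)

pascal-absorption : ∀ k n → suc k * pascal (suc k) n ≡ suc n * pascal k (suc n)
pascal-absorption zero    n       = trans (+-identityʳ _) (trans (pascal[1,n]≡1+n n) (sym (*-identityʳ (suc n))))
pascal-absorption (suc k) zero    =
  trans (*-identityʳ (suc (suc k))) (sym (trans (+-identityʳ _) (pascal[k,1]≡1+k (suc k))))
pascal-absorption (suc k) (suc n) = begin
  (2 + k) * (a + b)                   ≡⟨ *-distribˡ-+ (2 + k) a b ⟩
  (2 + k) * a + (2 + k) * b           ≡⟨ cong (_+_ ((2 + k) * a)) (pascal-absorption (suc k) n) ⟩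
  (2 + k) * a + (1 + n) * a           ≡⟨ shuffle k n a ⟩
  (1 + k) * a + (2 + n) * a           ≡⟨ cong (_+ (2 + n) * a) (pascal-absorption k (suc n)) ⟩
  (2 + n) * c + (2 + n) * a           ≡⟨ *-distribˡ-+ (2 + n) c a ⟨
  (2 + n) * (c + a)                   ∎
  where
  open ≡-Reasoning
  a = pascal (suc k) (suc n)
  b = pascal (suc (suc k)) n
  c = pascal k (suc (suc n))
  shuffle : ∀ k n a → (2 + k) * a + (1 + n) * a ≡ (1 + k) * a + (2 + n) * a
  shuffle = solve-∀

sumBelow-pascal : ∀ k n → suc k * sumBelow (pascal k) n ≡ n * pascal k n
sumBelow-pascal k zero    = *-zeroʳ (suc k)
sumBelow-pascal k (suc n) = trans (cong (suc k *_) (pascal-hockeyStick k n)) (pascal-absorption k n)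

+-∸-+-≤ : ∀ s a t c → (s + a) ∸ (t + c) ≤ (s ∸ t) + (a ∸ c)
+-∸-+-≤ s a t c = m≤n+o⇒m∸n≤o (s + a) (t + c)
  (≤-trans (+-mono-≤ (m≤n+m∸n s t) (m≤n+m∸n a c)) (≤-reflexive (interchange t (s ∸ t) c (a ∸ c))))

sum-∷ʳ : ∀ {k} (xs : Vec ℕ k) y → sum (xs ∷ʳ y) ≡ sum xs + y
sum-∷ʳ []       y = +-comm y 0
sum-∷ʳ (x ∷ xs) y = trans (cong (_+_ x) (sum-∷ʳ xs y)) (sym (+-assoc x (sum xs) y))

sum-initial : ∀ k → sum (initial k) ≡ 0
sum-initial zero    = refl
sum-initial (suc k) = sum-initial k

initial-∷ʳ : ∀ k → initial (suc k) ≡ initial k ∷ʳ 0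
initial-∷ʳ zero    = refl
initial-∷ʳ (suc k) = cong (0 ∷_) (initial-∷ʳ k)

cumulative : ∀ {k} → ℕ → Vec ℕ k → Vec ℕ k
cumulative t []       = []
cumulative t (c ∷ cs) = (t + c) ∷ cumulative (t + c) cs

cumulative-∷ʳ : ∀ {k} t (xs : Vec ℕ k) y → cumulative t (xs ∷ʳ y) ≡ cumulative t xs ∷ʳ (t + sum xs + y)
cumulative-∷ʳ t []       y = cong (λ s → (s + y) ∷ []) (sym (+-identityʳ t))
cumulative-∷ʳ t (x ∷ xs) y = cong ((t + x) ∷_) (trans (cumulative-∷ʳ (t + x) xs y)
  (cong (λ s → cumulative (t + x) xs ∷ʳ (s + y)) (+-assoc t x (sum xs))))

excess : ∀ {k} → State k → Vec ℕ k → ℕ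
excess []       []       = 0
excess (a ∷ as) (c ∷ cs) = (a ∸ c) + excess as cs

excessUpTo : ∀ {k} → Fin k → State k → Vec ℕ k → ℕ
excessUpTo zero    (a ∷ as) (c ∷ cs) = a ∸ c
excessUpTo (suc i) (a ∷ as) (c ∷ cs) = (a ∸ c) + excessUpTo i as cs

excessAfter : ∀ {k} → Fin k → State k → Vec ℕ k → ℕ
excessAfter zero    (a ∷ as) (c ∷ cs) = excess as cs
excessAfter (suc i) (a ∷ as) (c ∷ cs) = excessAfter i as cs

excess-split : ∀ {k} (i : Fin k) st c → excess st c ≡ excessUpTo i st c + excessAfter i st c
excess-split zero    (a ∷ as) (c ∷ cs) = refl
excess-split (suc i) (a ∷ as) (c ∷ cs) =
  trans (cong (_+_ (a ∸ c)) (excess-split i as cs)) (sym (+-assoc (a ∸ c) _ _))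

excess-initial : ∀ {k} (c : Vec ℕ k) → excess (initial k) c ≡ 0
excess-initial []       = refl
excess-initial (c ∷ cs) = trans (cong (_+ excess (initial _) cs) (0∸n≡0 c)) (excess-initial cs)

sum∸sum≤excess : ∀ {k} (st c : Vec ℕ k) → sum st ∸ sum c ≤ excess st c
sum∸sum≤excess []       []       = z≤n
sum∸sum≤excess (a ∷ as) (c ∷ cs) =
  ≤-trans (+-∸-+-≤ a (sum as) c (sum cs)) (+-monoʳ-≤ (a ∸ c) (sum∸sum≤excess as cs))

sum-mergeAux : ∀ {k} s (i : Fin k) st → sum (proj₂ (mergeAux s i st)) ≡ s + sum st
sum-mergeAux s zero    (a ∷ as) = +-assoc s a (sum as)
sum-mergeAux s (suc i) (a ∷ as) with mergeAux (s + a) i as | sum-mergeAux (s + a) i as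
... | _ , as′ | eq = trans eq (+-assoc s a (sum as))

excess-mergeAux : ∀ {k} s (i : Fin k) st c →
  excess (proj₂ (mergeAux s i st)) c ≤ proj₁ (mergeAux s i st) + excessAfter i st c
excess-mergeAux s zero    (a ∷ as) (c ∷ cs) = +-monoˡ-≤ (excess as cs) (m∸n≤m (s + a) c)
excess-mergeAux s (suc i) (a ∷ as) (c ∷ cs) with mergeAux (s + a) i as | excess-mergeAux (s + a) i as cs
... | _ , as′ | ih = ≤-trans (≤-reflexive (cong (_+ excess as′ cs) (0∸n≡0 c))) ih

excess-mergeAux-cumulative : ∀ {k} s t (i : Fin k) st c →
  excess (proj₂ (mergeAux s i st)) (cumulative t c)
    ≤ (s ∸ t) + excessUpTo i st c + excessAfter i st (cumulative t c)
excess-mergeAux-cumulative s t zero    (a ∷ as) (c ∷ cs) =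
  +-monoˡ-≤ (excess as (cumulative (t + c) cs)) (+-∸-+-≤ s a t c)
excess-mergeAux-cumulative s t (suc i) (a ∷ as) (c ∷ cs)
  with mergeAux (s + a) i as | excess-mergeAux-cumulative (s + a) (t + c) i as cs
... | _ , as′ | ih = begin
  (0 ∸ (t + c)) + excess as′ (cumulative (t + c) cs)
    ≡⟨ cong (_+ excess as′ (cumulative (t + c) cs)) (0∸n≡0 (t + c)) ⟩
  excess as′ (cumulative (t + c) cs)
    ≤⟨ ih ⟩
  ((s + a) ∸ (t + c)) + excessUpTo i as cs + rest
    ≤⟨ +-monoˡ-≤ rest (+-monoˡ-≤ (excessUpTo i as cs) (+-∸-+-≤ s a t c)) ⟩
  ((s ∸ t) + (a ∸ c)) + excessUpTo i as cs + rest
    ≡⟨ cong (_+ rest) (+-assoc (s ∸ t) (a ∸ c) _) ⟩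
  (s ∸ t) + ((a ∸ c) + excessUpTo i as cs) + rest
    ∎
  where
  open ≤-Reasoning
  rest = excessAfter i as (cumulative (t + c) cs)

data FillsZero : ∀ {k} → State k → State k → Set where
  here  : ∀ {k} {as : State k} → FillsZero (0 ∷ as) (1 ∷ as)
  there : ∀ {k a} {as bs : State k} → FillsZero as bs → FillsZero (a ∷ as) (a ∷ bs)

data FillOutcome {k} (st : State k) : Bool × State k → Set where
  unchanged : FillOutcome st (false , st)
  filled    : ∀ {st′} → FillsZero st st′ → FillOutcome st (true , st′)

fillLastEmpty-outcome : ∀ {k} (st : State k) → FillOutcome st (fillLastEmpty st)
fillLastEmpty-outcome []       = unchanged
fillLastEmpty-outcome (a ∷ as) with fillLastEmpty as | fillLastEmpty-outcome as
... | true  , _   | filled p  = filled (there p)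
... | false , .as | unchanged with a
...   | zero  = filled here
...   | suc _ = unchanged

sum-fillsZero : ∀ {k} {st st′ : State k} → FillsZero st st′ → sum st′ ≡ suc (sum st)
sum-fillsZero here                 = refl
sum-fillsZero (there {a = a} p) = trans (cong (_+_ a) (sum-fillsZero p)) (+-suc a _)

excess-fillsZero : ∀ {k} {st st′ : State k} → FillsZero st st′ → ∀ c → excess st′ c ≤ suc (excess st c)
excess-fillsZero here               (zero  ∷ cs) = ≤-refl
excess-fillsZero (here {as = as})   (suc c ∷ cs) =
  ≤-trans (≤-reflexive (cong (_+ excess as cs) (0∸n≡0 c))) (n≤1+n _)
excess-fillsZero (there {a = a} p) (c ∷ cs) =
  ≤-trans (+-monoʳ-≤ (a ∸ c) (excess-fillsZero p cs)) (≤-reflexive (+-suc (a ∸ c) _))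

excess-fillsZero-cumulative : ∀ {k} {st st′ : State k} → FillsZero st st′ →
  ∀ t c → excess st′ (cumulative (suc t) c) ≤ excess st (cumulative (suc t) c)
excess-fillsZero-cumulative (here {as = as}) t (c ∷ cs) =
  ≤-reflexive (cong (_+ excess as (cumulative (suc (t + c)) cs)) (0∸n≡0 (t + c)))
excess-fillsZero-cumulative (there {a = a} p) t (c ∷ cs) =
  +-monoʳ-≤ (a ∸ suc (t + c)) (excess-fillsZero-cumulative p (t + c) cs)

levels : (k r : ℕ) → Vec ℕ k
levels k zero    = initial k
levels k (suc r) = cumulative 1 (levels k r)

levelsLast : ℕ → ℕ → ℕ
levelsLast k zero    = 0
levelsLast k (suc r) = suc (sum (levels (suc k) r))

levels-∷ʳ : ∀ k r → levels (suc k) r ≡ levels k r ∷ʳ levelsLast k r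
levels-∷ʳ k zero    = initial-∷ʳ k
levels-∷ʳ k (suc r) = begin
  cumulative 1 (levels (suc k) r)                             ≡⟨ cong (cumulative 1) (levels-∷ʳ k r) ⟩
  cumulative 1 (levels k r ∷ʳ levelsLast k r)                 ≡⟨ cumulative-∷ʳ 1 (levels k r) _ ⟩
  levels k (suc r) ∷ʳ suc (sum (levels k r) + levelsLast k r) ≡⟨ cong (λ s → levels k (suc r) ∷ʳ suc s) sum-last ⟩
  levels k (suc r) ∷ʳ levelsLast k (suc r)                    ∎
  where
  open ≡-Reasoning
  sum-last : sum (levels k r) + levelsLast k r ≡ sum (levels (suc k) r)
  sum-last = sym (trans (cong sum (levels-∷ʳ k r)) (sum-∷ʳ (levels k r) _))

sum-levels : ∀ k r → suc (sum (levels k r)) ≡ pascal k r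
sum-levels zero    r       with levels zero r
... | [] = refl
sum-levels (suc k) zero    = cong suc (sum-initial (suc k))
sum-levels (suc k) (suc r) = begin
  suc (sum (levels (suc k) (suc r)))                               ≡⟨ cong (suc ∘ sum) (levels-∷ʳ k (suc r)) ⟩
  suc (sum (levels k (suc r) ∷ʳ levelsLast k (suc r)))             ≡⟨ cong suc (sum-∷ʳ (levels k (suc r)) _) ⟩
  suc (sum (levels k (suc r))) + suc (sum (levels (suc k) r))      ≡⟨ cong₂ _+_ (sum-levels k (suc r)) (sum-levels (suc k) r) ⟩
  pascal k (suc r) + pascal (suc k) r                              ∎
  where open ≡-Reasoning

potential : ∀ {k} → ℕ → State k → ℕ
potential {k} R st = sumBelow (λ r → excess st (levels k r)) R

potential-initial : ∀ {k} R → potential R (initial k) ≡ 0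
potential-initial zero    = refl
potential-initial {k} (suc R) =
  cong₂ _+_ (excess-initial (levels k R)) (potential-initial {k} R)

potential-fillsZero : ∀ {k} {st st′ : State k} → FillsZero st st′ →
  ∀ R → potential R st′ ≤ suc (potential R st)
potential-fillsZero p zero          = z≤n
potential-fillsZero p (suc zero)    = +-monoˡ-≤ 0 (excess-fillsZero p _)
potential-fillsZero {k} {st} p (suc (suc R)) =
  ≤-trans (+-mono-≤ (excess-fillsZero-cumulative p 0 (levels k R)) (potential-fillsZero p (suc R)))
          (≤-reflexive (+-suc (excess st (levels k (suc R))) _))

-- The merged prefix is charged one level higher than before, the untouched suffix at the same level.
potential-merge-suc : ∀ {k} R (i : Fin k) st →
  potential (suc R) (proj₂ (merge i st))
    ≤ proj₁ (merge i st) + potential R st + excessAfter i st (levels k R)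
potential-merge-suc {k} zero i st = begin
  excess (proj₂ (merge i st)) (initial k) + 0         ≡⟨ +-identityʳ _ ⟩
  excess (proj₂ (merge i st)) (initial k)             ≤⟨ excess-mergeAux 1 i st (initial k) ⟩
  x + excessAfter i st (initial k)                    ≡⟨ cong (_+ excessAfter i st (initial k)) (+-identityʳ x) ⟨
  x + 0 + excessAfter i st (initial k)                ∎
  where
  open ≤-Reasoning
  x = proj₁ (merge i st)
potential-merge-suc {k} (suc R) i st = begin
  excess st′ (levels k (suc R)) + potential (suc R) st′
    ≤⟨ +-mono-≤ (excess-mergeAux-cumulative 1 1 i st (levels k R)) (potential-merge-suc R i st) ⟩
  (upTo + after′) + (x + potential R st + after)
    ≡⟨ shuffle upTo after′ x (potential R st) after ⟩
  x + ((upTo + after) + potential R st) + after′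
    ≡⟨ cong (λ e → x + (e + potential R st) + after′) (sym (excess-split i st (levels k R))) ⟩
  x + potential (suc R) st + after′
    ∎
  where
  open ≤-Reasoning
  st′ = proj₂ (merge i st)
  x = proj₁ (merge i st)
  upTo = excessUpTo i st (levels k R)
  after = excessAfter i st (levels k R)
  after′ = excessAfter i st (levels k (suc R))
  shuffle : ∀ u a′ x p a → (u + a′) + (x + p + a) ≡ x + ((u + a) + p) + a′
  shuffle = solve-∀

potential-merge : ∀ {k} R (i : Fin k) st →
  potential R (proj₂ (merge i st)) ≤ proj₁ (merge i st) + potential R st
potential-merge     zero    i st = z≤n
potential-merge {k} (suc R) i st = begin
  potential (suc R) (proj₂ (merge i st))
    ≤⟨ potential-merge-suc R i st ⟩
  x + potential R st + excessAfter i st (levels k R)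
    ≤⟨ +-monoʳ-≤ (x + potential R st) (≤-trans (m≤n+m _ _) (≤-reflexive (sym (excess-split i st (levels k R))))) ⟩
  x + potential R st + excess st (levels k R)
    ≡⟨ +-assoc x _ _ ⟩
  x + (potential R st + excess st (levels k R))
    ≡⟨ cong (_+_ x) (+-comm (potential R st) _) ⟩
  x + potential (suc R) st
    ∎
  where
  open ≤-Reasoning
  x = proj₁ (merge i st)

potential-step : ∀ {k} R (i : Fin k) st →
  potential R (proj₂ (step i st)) ≤ proj₁ (step i st) + potential R st
potential-step R i st with fillLastEmpty st | fillLastEmpty-outcome st
... | true  , _   | filled p  = potential-fillsZero p R
... | false , .st | unchanged = potential-merge R i st

sum-step : ∀ {k} (i : Fin k) st → sum (proj₂ (step i st)) ≡ suc (sum st)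
sum-step i st with fillLastEmpty st | fillLastEmpty-outcome st
... | true  , _   | filled p  = sum-fillsZero p
... | false , .st | unchanged = sum-mergeAux 1 i st

runState : ∀ {k N} → Vec (Fin k) N → State k → State k
runState []       st = st
runState (i ∷ is) st with step i st
... | _ , st′ = runState is st′

potential-run : ∀ {k N} R (σ : Vec (Fin k) N) st →
  potential R (runState σ st) ≤ runCost σ st + potential R st
potential-run R []       st = ≤-refl
potential-run R (i ∷ is) st with step i st | potential-step R i st
... | c , st′ | h = begin
  potential R (runState is st′)       ≤⟨ potential-run R is st′ ⟩
  runCost is st′ + potential R st′    ≤⟨ +-monoʳ-≤ (runCost is st′) h ⟩
  runCost is st′ + (c + potential R st) ≡⟨ +-assoc (runCost is st′) c _ ⟨
  runCost is st′ + c + potential R st ≡⟨ cong (_+ potential R st) (+-comm (runCost is st′) c) ⟩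
  c + runCost is st′ + potential R st ∎
  where open ≤-Reasoning

sum-run : ∀ {k N} (σ : Vec (Fin k) N) st → sum (runState σ st) ≡ N + sum st
sum-run []       st = refl
sum-run {N = suc N} (i ∷ is) st with step i st | sum-step i st
... | _ , st′ | eq = trans (sum-run is st′) (trans (cong (_+_ N) eq) (+-suc N (sum st)))

sumBelow-∸levels≤runCost : ∀ {k N} R (σ : Vec (Fin k) N) →
  sumBelow (λ r → N ∸ sum (levels k r)) R ≤ runCost σ (initial k)
sumBelow-∸levels≤runCost {k} {N} R σ = begin
  sumBelow (λ r → N ∸ sum (levels k r)) R               ≡⟨ cong (λ m → sumBelow (λ r → m ∸ sum (levels k r)) R) N≡sum ⟩
  sumBelow (λ r → sum final ∸ sum (levels k r)) R       ≤⟨ sumBelow-mono (λ r → sum∸sum≤excess final (levels k r)) R ⟩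
  potential R final                                     ≤⟨ potential-run R σ (initial k) ⟩
  runCost σ (initial k) + potential R (initial k)       ≡⟨ cong (_+_ (runCost σ (initial k))) (potential-initial {k} R) ⟩
  runCost σ (initial k) + 0                             ≡⟨ +-identityʳ _ ⟩
  runCost σ (initial k)                                 ∎
  where
  open ≤-Reasoning
  final = runState σ (initial k)
  N≡sum : N ≡ sum final
  N≡sum = sym (trans (sum-run σ (initial k)) (trans (cong (_+_ N) (sum-initial k)) (+-identityʳ N)))

suc≤∸levels+pascal : ∀ k N r → suc N ≤ (N ∸ sum (levels k r)) + pascal k r
suc≤∸levels+pascal k N r = begin
  suc N               ≤⟨ s≤s (m≤n+m∸n N G) ⟩
  suc (G + (N ∸ G))   ≡⟨ cong suc (+-comm G (N ∸ G)) ⟩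
  suc ((N ∸ G) + G)   ≡⟨ +-suc (N ∸ G) G ⟨
  (N ∸ G) + suc G     ≡⟨ cong (_+_ (N ∸ G)) (sum-levels k r) ⟩
  (N ∸ G) + pascal k r ∎
  where
  open ≤-Reasoning
  G = sum (levels k r)

strategyCost-lowerBound : ∀ {k N} R (σ : Vec (Fin k) N) →
  suc k * (R * suc N) ≤ suc k * strategyCost N k σ + R * pascal k R
strategyCost-lowerBound {k} {N} R σ = begin
  suc k * (R * suc N)                   ≤⟨ *-monoʳ-≤ (suc k) (*≤sumBelow+sumBelow (suc≤∸levels+pascal k N) R) ⟩
  suc k * (L + S)                       ≡⟨ *-distribˡ-+ (suc k) L S ⟩
  suc k * L + suc k * S                 ≤⟨ +-mono-≤ (*-monoʳ-≤ (suc k) (sumBelow-∸levels≤runCost R σ))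
                                                   (≤-reflexive (sumBelow-pascal k R)) ⟩
  suc k * strategyCost N k σ + R * pascal k R ∎
  where
  open ≤-Reasoning
  L = sumBelow (λ r → N ∸ sum (levels k r)) R
  S = sumBelow (pascal k) R

runCost-∷ : ∀ {k N c st′} (i : Fin k) (is : Vec (Fin k) N) st →
  step i st ≡ (c , st′) → runCost (i ∷ is) st ≡ c + runCost is st′
runCost-∷ i is st eq rewrite eq = refl

runState-∷ : ∀ {k N c st′} (i : Fin k) (is : Vec (Fin k) N) st →
  step i st ≡ (c , st′) → runState (i ∷ is) st ≡ runState is st′
runState-∷ i is st eq rewrite eq = refl

runCost-++ : ∀ {k M N} (u : Vec (Fin k) M) (v : Vec (Fin k) N) st →
  runCost (u ++ v) st ≡ runCost u st + runCost v (runState u st)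
runCost-++ []       v st = refl
runCost-++ (i ∷ u) v st with step i st
... | c , st′ = trans (cong (_+_ c) (runCost-++ u v st′)) (sym (+-assoc c _ _))

runState-++ : ∀ {k M N} (u : Vec (Fin k) M) (v : Vec (Fin k) N) st →
  runState (u ++ v) st ≡ runState v (runState u st)
runState-++ []      v st = refl
runState-++ (i ∷ u) v st with step i st
... | _ , st′ = runState-++ u v st′

fillLastEmpty-∷ʳ : ∀ {k} (xs : State k) b →
  fillLastEmpty (xs ∷ʳ suc b) ≡ (proj₁ (fillLastEmpty xs) , proj₂ (fillLastEmpty xs) ∷ʳ suc b)
fillLastEmpty-∷ʳ []       b = refl
fillLastEmpty-∷ʳ (x ∷ xs) b rewrite fillLastEmpty-∷ʳ xs b with fillLastEmpty xs
... | true  , _ = refl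
... | false , _ with x
...   | zero  = refl
...   | suc _ = refl

mergeAux-inject₁ : ∀ {k} s (i : Fin k) (xs : State k) y →
  mergeAux s (inject₁ i) (xs ∷ʳ y) ≡ (proj₁ (mergeAux s i xs) , proj₂ (mergeAux s i xs) ∷ʳ y)
mergeAux-inject₁ s zero    (a ∷ xs) y = refl
mergeAux-inject₁ s (suc i) (a ∷ xs) y rewrite mergeAux-inject₁ (s + a) i xs y with mergeAux (s + a) i xs
... | _ , _ = refl

step-inject₁ : ∀ {k} (i : Fin k) (xs : State k) b →
  step (inject₁ i) (xs ∷ʳ suc b) ≡ (proj₁ (step i xs) , proj₂ (step i xs) ∷ʳ suc b)
step-inject₁ i xs b rewrite fillLastEmpty-∷ʳ xs b with fillLastEmpty xs
... | true  , _ = refl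
... | false , _ = mergeAux-inject₁ 1 i xs (suc b)

runCost-inject₁ : ∀ {k N} (σ : Vec (Fin k) N) (xs : State k) b →
  runCost (map inject₁ σ) (xs ∷ʳ suc b) ≡ runCost σ xs
runCost-inject₁ []      xs b = refl
runCost-inject₁ (i ∷ σ) xs b rewrite step-inject₁ i xs b with step i xs
... | c , ys = cong (_+_ c) (runCost-inject₁ σ ys b)

runState-inject₁ : ∀ {k N} (σ : Vec (Fin k) N) (xs : State k) b →
  runState (map inject₁ σ) (xs ∷ʳ suc b) ≡ runState σ xs ∷ʳ suc b
runState-inject₁ []      xs b = refl
runState-inject₁ (i ∷ σ) xs b rewrite step-inject₁ i xs b with step i xs
... | _ , ys = runState-inject₁ σ ys b

fillLastEmpty-initial : ∀ k → fillLastEmpty (initial (suc k)) ≡ (true , initial k ∷ʳ 1)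
fillLastEmpty-initial zero    = refl
fillLastEmpty-initial (suc k) rewrite fillLastEmpty-initial k = refl

fillLastEmpty-cumulative : ∀ {k} t (c : Vec ℕ k) →
  fillLastEmpty (cumulative (suc t) c) ≡ (false , cumulative (suc t) c)
fillLastEmpty-cumulative t []       = refl
fillLastEmpty-cumulative t (c ∷ cs) rewrite fillLastEmpty-cumulative (t + c) cs = refl

mergeAux-fromℕ : ∀ {k} s (st : State (suc k)) →
  mergeAux s (fromℕ k) st ≡ (s + sum st , initial k ∷ʳ (s + sum st))
mergeAux-fromℕ {zero}  s (a ∷ []) rewrite +-identityʳ a = refl
mergeAux-fromℕ {suc k} s (a ∷ as) rewrite mergeAux-fromℕ (s + a) as | +-assoc s a (sum as) = refl

step-fromℕ-levels : ∀ k n →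
  step (fromℕ k) (levels (suc k) n) ≡ (pascal (suc k) n , initial k ∷ʳ pascal (suc k) n)
step-fromℕ-levels k zero    rewrite fillLastEmpty-initial k = refl
step-fromℕ-levels k (suc n)
  rewrite fillLastEmpty-cumulative 0 (levels (suc k) n)
        | mergeAux-fromℕ 1 (levels (suc k) (suc n))
        | sum-levels (suc k) (suc n) = refl

optimalLength : ℕ → ℕ → ℕ
optimalLength zero    n       = 0
optimalLength (suc k) zero    = 0
optimalLength (suc k) (suc n) = optimalLength (suc k) n + suc (optimalLength k (suc n))

optimalStrategy : (k n : ℕ) → Vec (Fin k) (optimalLength k n)
optimalStrategy zero    n       = []
optimalStrategy (suc k) zero    = []
optimalStrategy (suc k) (suc n) =
  optimalStrategy (suc k) n ++ fromℕ k ∷ map inject₁ (optimalStrategy k (suc n))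

runState-optimal : ∀ k n → runState (optimalStrategy k n) (initial k) ≡ levels k n
runState-optimal zero    n       with levels zero n
... | [] = refl
runState-optimal (suc k) zero    = refl
runState-optimal (suc k) (suc n) = begin
  runState (optimalStrategy (suc k) n ++ fromℕ k ∷ lifted) (initial (suc k))
    ≡⟨ runState-++ (optimalStrategy (suc k) n) (fromℕ k ∷ lifted) (initial (suc k)) ⟩
  runState (fromℕ k ∷ lifted) (runState (optimalStrategy (suc k) n) (initial (suc k)))
    ≡⟨ cong (runState (fromℕ k ∷ lifted)) (runState-optimal (suc k) n) ⟩
  runState (fromℕ k ∷ lifted) (levels (suc k) n)
    ≡⟨ runState-∷ (fromℕ k) lifted (levels (suc k) n) (step-fromℕ-levels k n) ⟩
  runState lifted (initial k ∷ʳ pascal (suc k) n)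
    ≡⟨ cong (runState lifted) (cong (initial k ∷ʳ_) (sym (sum-levels (suc k) n))) ⟩
  runState lifted (initial k ∷ʳ levelsLast k (suc n))
    ≡⟨ runState-inject₁ (optimalStrategy k (suc n)) (initial k) _ ⟩
  runState (optimalStrategy k (suc n)) (initial k) ∷ʳ levelsLast k (suc n)
    ≡⟨ cong (_∷ʳ levelsLast k (suc n)) (runState-optimal k (suc n)) ⟩
  levels k (suc n) ∷ʳ levelsLast k (suc n)
    ≡⟨ levels-∷ʳ k (suc n) ⟨
  levels (suc k) (suc n)
    ∎
  where
  open ≡-Reasoning
  lifted = map inject₁ (optimalStrategy k (suc n))

suc-optimalLength : ∀ k n → suc (optimalLength k n) ≡ pascal k n
suc-optimalLength k n = begin
  suc (optimalLength k n)                                     ≡⟨ cong suc (+-identityʳ _) ⟨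
  suc (optimalLength k n + 0)                                 ≡⟨ cong (λ s → suc (optimalLength k n + s)) (sum-initial k) ⟨
  suc (optimalLength k n + sum (initial k))                   ≡⟨ cong suc (sum-run (optimalStrategy k n) (initial k)) ⟨
  suc (sum (runState (optimalStrategy k n) (initial k)))      ≡⟨ cong (suc ∘ sum) (runState-optimal k n) ⟩
  suc (sum (levels k n))                                      ≡⟨ sum-levels k n ⟩
  pascal k n                                                  ∎
  where open ≡-Reasoning

runCost-optimal : ∀ k n → runCost (optimalStrategy k n) (initial k) ≡ k * sumBelow (pascal k) n
runCost-optimal zero    n       = refl
runCost-optimal (suc k) zero    = sym (*-zeroʳ (suc k))
runCost-optimal (suc k) (suc n) = begin
  runCost (optimalStrategy (suc k) n ++ fromℕ k ∷ lifted) (initial (suc k))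
    ≡⟨ runCost-++ (optimalStrategy (suc k) n) (fromℕ k ∷ lifted) (initial (suc k)) ⟩
  runCost (optimalStrategy (suc k) n) (initial (suc k))
    + runCost (fromℕ k ∷ lifted) (runState (optimalStrategy (suc k) n) (initial (suc k)))
    ≡⟨ cong₂ _+_ (runCost-optimal (suc k) n) (cong (runCost (fromℕ k ∷ lifted)) (runState-optimal (suc k) n)) ⟩
  suc k * S + runCost (fromℕ k ∷ lifted) (levels (suc k) n)
    ≡⟨ cong (_+_ (suc k * S)) (runCost-∷ (fromℕ k) lifted (levels (suc k) n) (step-fromℕ-levels k n)) ⟩
  suc k * S + (P + runCost lifted (initial k ∷ʳ P))
    ≡⟨ cong (λ c → suc k * S + (P + c)) lifted-cost ⟩
  suc k * S + (P + k * P)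
    ≡⟨ *-distribˡ-+ (suc k) S P ⟨
  suc k * (S + P)
    ≡⟨ cong (suc k *_) (+-comm S P) ⟩
  suc k * sumBelow (pascal (suc k)) (suc n)
    ∎
  where
  open ≡-Reasoning
  lifted = map inject₁ (optimalStrategy k (suc n))
  S = sumBelow (pascal (suc k)) n
  P = pascal (suc k) n
  lifted-cost : runCost lifted (initial k ∷ʳ P) ≡ k * P
  lifted-cost = begin
    runCost lifted (initial k ∷ʳ P)
      ≡⟨ cong (λ p → runCost lifted (initial k ∷ʳ p)) (sym (sum-levels (suc k) n)) ⟩
    runCost lifted (initial k ∷ʳ suc (sum (levels (suc k) n)))
      ≡⟨ runCost-inject₁ (optimalStrategy k (suc n)) (initial k) _ ⟩
    runCost (optimalStrategy k (suc n)) (initial k)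
      ≡⟨ runCost-optimal k (suc n) ⟩
    k * sumBelow (pascal k) (suc n)
      ≡⟨ cong (k *_) (pascal-hockeyStick k n) ⟩
    k * P
      ∎

minCost≤runCost : ∀ {k M N c} → IsMinCost N k c → (σ : Vec (Fin k) M) → M ≡ N → c ≤ runCost σ (initial k)
minCost≤runCost (_ , minimal) σ refl = minimal σ

minCost-at-pascal : ∀ k n N c → suc N ≡ pascal k n → IsMinCost N k c → suc k * c ≡ k * (n * suc N)
minCost-at-pascal k n N c N+1≡P minCost@((σ , cost≡c) , _) = ≤-antisym upper lower
  where
  open ≤-Reasoning
  upper : suc k * c ≤ k * (n * suc N)
  upper = begin
    suc k * c
      ≤⟨ *-monoʳ-≤ (suc k) (minCost≤runCost minCost (optimalStrategy k n)
                                             (suc-injective (trans (suc-optimalLength k n) (sym N+1≡P)))) ⟩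
    suc k * runCost (optimalStrategy k n) (initial k)
      ≡⟨ cong (suc k *_) (runCost-optimal k n) ⟩
    suc k * (k * sumBelow (pascal k) n)
      ≡⟨ m*[n*o]≡n*[m*o] (suc k) k _ ⟩
    k * (suc k * sumBelow (pascal k) n)
      ≡⟨ cong (k *_) (sumBelow-pascal k n) ⟩
    k * (n * pascal k n)
      ≡⟨ cong (λ p → k * (n * p)) N+1≡P ⟨
    k * (n * suc N)
      ∎
  lower : k * (n * suc N) ≤ suc k * c
  lower = +-cancelˡ-≤ (n * suc N) _ _ (begin
    suc k * (n * suc N)                ≤⟨ strategyCost-lowerBound n σ ⟩
    suc k * strategyCost N k σ + n * pascal k n
      ≡⟨ cong₂ (λ x p → suc k * x + n * p) cost≡c (sym N+1≡P) ⟩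
    suc k * c + n * suc N              ≡⟨ +-comm (suc k * c) _ ⟩
    n * suc N + suc k * c              ∎)

minCost-lowerBound : ∀ k n N c → (n + k ∸ 1) C k ≤ N → IsMinCost N k c → k * (n ∸ 1) * N ≤ suc k * c
minCost-lowerBound k zero    N c _ _ rewrite *-zeroʳ k = z≤n
minCost-lowerBound k (suc m) N c C≤N ((σ , cost≡c) , _) = +-cancelʳ-≤ (m * N) _ _ (begin
  k * m * N + m * N                    ≤⟨ m≤m+n _ (suc k * m) ⟩
  k * m * N + m * N + suc k * m        ≡⟨ expand k m N ⟨
  suc k * (m * suc N)                  ≤⟨ strategyCost-lowerBound m σ ⟩
  suc k * strategyCost N k σ + m * pascal k m
    ≤⟨ +-mono-≤ (≤-reflexive (cong (suc k *_) cost≡c)) (*-monoʳ-≤ m (≤-trans (≤-reflexive (pascal≡C k m)) C≤N)) ⟩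
  suc k * c + m * N                    ∎)
  where
  open ≤-Reasoning
  expand : ∀ k m N → suc k * (m * suc N) ≡ k * m * N + m * N + suc k * m
  expand = solve-∀

*≤*⇒+/≤+/ : ∀ a b c d .{{_ : NonZero b}} .{{_ : NonZero d}} → a * d ≤ c * b → (+ a) / b ≤ℚ (+ c) / d
*≤*⇒+/≤+/ a (suc b) c (suc d) ad≤cb =
  toℚᵘ-cancel-≤ (ℚᵘ.≤-respˡ-≃ (ℚᵘ.≃-sym (toℚᵘ-fromℚᵘ (ℚᵘ.mkℚᵘ (+ a) b)))
    (ℚᵘ.≤-respʳ-≃ (ℚᵘ.≃-sym (toℚᵘ-fromℚᵘ (ℚᵘ.mkℚᵘ (+ c) d)))
      (ℚᵘ.*≤* (subst₂ ℤ._≤_ (pos-* a (suc d)) (pos-* c (suc b)) (ℤ.+≤+ ad≤cb)))))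

*[1+k]≤*k*2 : ∀ j k → 1 ≤ k → j * suc k ≤ k * j * 2
*[1+k]≤*k*2 j k 1≤k = begin
  j * suc k      ≤⟨ *-monoʳ-≤ j (+-monoˡ-≤ k 1≤k) ⟩
  j * (k + k)    ≡⟨ double j k ⟩
  k * j * 2      ∎
  where
  open ≤-Reasoning
  double : ∀ j k → j * (k + k) ≡ k * j * 2
  double = solve-∀

corollary8p8 : (k n : ℕ) → 1 ≤ k →
    (((N c : ℕ) → N ≡ (n + k) C k ∸ 1 → IsMinCost N k c →
        (k + 1) * c ≡ k * n * (N + 1))
    ×
     ((N c : ℕ) → (n + k ∸ 1) C k ≤ N → N ≤ (n + k) C k ∸ 1 → IsMinCost N k c →
        ((k + 1) * c ≥ k * (n ∸ 1) * N)
        × (.{{_ : NonZero N}} →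
            ((+ (k * (n ∸ 1))) / suc k ≤ℚ (+ c) / N)
            × ((+ (n ∸ 1)) / 2 ≤ℚ (+ (k * (n ∸ 1))) / suc k))))
corollary8p8 k n 1≤k = exact , λ N c C≤N _ minCost →
  let lower = minCost-lowerBound k n N c C≤N minCost in
  subst (λ m → k * (n ∸ 1) * N ≤ m * c) (+-comm 1 k) lower ,
  λ .{{_}} → *≤*⇒+/≤+/ (k * (n ∸ 1)) (suc k) c N (≤-trans lower (≤-reflexive (*-comm (suc k) c))) ,
             *≤*⇒+/≤+/ (n ∸ 1) 2 (k * (n ∸ 1)) (suc k) (*[1+k]≤*k*2 (n ∸ 1) k 1≤k)
  where
  exact : ∀ N c → N ≡ (n + k) C k ∸ 1 → IsMinCost N k c → (k + 1) * c ≡ k * n * (N + 1)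
  exact N c refl minCost = begin
    (k + 1) * c        ≡⟨ cong (_* c) (+-comm k 1) ⟩
    suc k * c          ≡⟨ minCost-at-pascal k n N c N+1≡P minCost ⟩
    k * (n * suc N)    ≡⟨ *-assoc k n _ ⟨
    k * n * suc N      ≡⟨ cong (k * n *_) (+-comm 1 N) ⟩
    k * n * (N + 1)    ∎
    where
    open ≡-Reasoning
    N+1≡P : suc ((n + k) C k ∸ 1) ≡ pascal k n
    N+1≡P rewrite sym (pascal≡C k n) | sym (sum-levels k n) = refl
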